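{- Let $(G,\sigma)$ be a signed $2$-edge-connected subcubic graph (parallel edges allowed) with $|E^-_{(G,\sigma)}|=F(G,\sigma)$. If $F(G,\sigma)=\tfrac12 v(G)$, then either $(G,\sigma)$ is isomorphic to $\widehat{\Gamma}_1$ up to switching, or every vertex of $(G,\sigma)$ lies in a digon.
   Context: A signed graph $(G,\sigma)$ is a (loopless, possibly with parallel edges) graph with a signature $\sigma:E(G)\to\{+,-\}$; $E^-_{(G,\sigma)}$ is its set of negative edges. Switching at an edge cut changes the sign of every edge of the cut; switching equivalence and frustration index $F(G,\sigma)=\min|E^-_{(G,\sigma')}|$ over switching-equivalent $\sigma'$. Subcubic means every vertex has degree at most $3$. A digon is a pair of vertices joined by two parallel edges, one positive and one negative. $\widehat{\Gamma}_1$ is $K_4$ on $\{p_1,p_2,p_3,p_4\}$ with $p_1p_2$ and $p_3p_4$ negative and the other four edges positive. -}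

module Defs where

open import Data.Nat using (ℕ; zero; suc; _+_; _*_; _≤_)
open import Data.Bool using (Bool; true; false; _xor_; not; T; _∨_)
open import Data.Fin using (Fin; zero; suc; _≟_)
open import Data.Product using (Σ; _×_; _,_; proj₁; proj₂)
open import Data.Sum using (_⊎_)
open import Relation.Nullary using (¬_)
open import Relation.Nullary.Decidable using (isYes)
open import Relation.Binary.PropositionalEquality using (_≡_; _≢_)
open import Function.Bundles using (_⤖_; Bijection)

record Graph : Set where
  field
    nV : ℕ
    nE : ℕ
    ends : Fin nE → Fin nV × Fin nV
    loopless : ∀ e → proj₁ (ends e) ≢ proj₂ (ends e)
open Graph public

-- A signature: true = negative edge, false = positive edge.
Signature : Graph → Set
Signature G = Fin (nE G) → Bool

b2n : Bool → ℕ
b2n true = 1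
b2n false = 0

countTrue : ∀ {k} → (Fin k → Bool) → ℕ
countTrue {zero} f = 0
countTrue {suc k} f = b2n (f zero) + countTrue (λ i → f (suc i))

incident : (G : Graph) → Fin (nE G) → Fin (nV G) → Bool
incident G e v = isYes (v ≟ proj₁ (ends G e)) ∨ isYes (v ≟ proj₂ (ends G e))

degree : (G : Graph) → Fin (nV G) → ℕ
degree G v = countTrue (λ e → incident G e v)

Subcubic : Graph → Set
Subcubic G = ∀ v → degree G v ≤ 3

data Reach (G : Graph) (ok : Fin (nE G) → Bool) : Fin (nV G) → Fin (nV G) → Set where
  here  : ∀ {u} → Reach G ok u u
  stepˡ : ∀ e {w} → T (ok e) → Reach G ok (proj₂ (ends G e)) w → Reach G ok (proj₁ (ends G e)) w
  stepʳ : ∀ e {w} → T (ok e) → Reach G ok (proj₁ (ends G e)) w → Reach G ok (proj₂ (ends G e)) w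

ConnectedUsing : (G : Graph) → (Fin (nE G) → Bool) → Set
ConnectedUsing G ok = ∀ u v → Reach G ok u v

TwoEdgeConnected : Graph → Set
TwoEdgeConnected G =
  ConnectedUsing G (λ _ → true) × (∀ e → ConnectedUsing G (λ e' → not (isYes (e' ≟ e))))

switch : (G : Graph) → (Fin (nV G) → Bool) → Signature G → Signature G
switch G X σ e = σ e xor (X (proj₁ (ends G e)) xor X (proj₂ (ends G e)))

negCount : (G : Graph) → Signature G → ℕ
negCount G σ = countTrue σ

IsFrustrationIndex : (G : Graph) → Signature G → ℕ → Set
IsFrustrationIndex G σ k =
  Σ (Fin (nV G) → Bool) (λ X → negCount G (switch G X σ) ≡ k)
  × (∀ X → k ≤ negCount G (switch G X σ))

Joins : (G : Graph) → Fin (nE G) → Fin (nV G) → Fin (nV G) → Set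
Joins G e v w =
  (proj₁ (ends G e) ≡ v × proj₂ (ends G e) ≡ w) ⊎ (proj₁ (ends G e) ≡ w × proj₂ (ends G e) ≡ v)

InDigon : (G : Graph) → Signature G → Fin (nV G) → Set
InDigon G σ v =
  Σ (Fin (nV G)) λ w → Σ (Fin (nE G)) λ e → Σ (Fin (nE G)) λ e' →
    Joins G e v w × Joins G e' v w × σ e ≡ false × σ e' ≡ true

record SignedIso (G : Graph) (σ : Signature G) (H : Graph) (τ : Signature H) : Set where
  field
    vmap : Fin (nV G) ⤖ Fin (nV H)
    emap : Fin (nE G) ⤖ Fin (nE H)
    preservesEnds : ∀ e → Joins H (Bijection.to emap e)
                             (Bijection.to vmap (proj₁ (ends G e)))
                             (Bijection.to vmap (proj₂ (ends G e)))
    preservesSign : ∀ e → τ (Bijection.to emap e) ≡ σ e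

IsoUpToSwitching : (G : Graph) → Signature G → (H : Graph) → Signature H → Set
IsoUpToSwitching G σ H τ = Σ (Fin (nV G) → Bool) λ X → SignedIso G (switch G X σ) H τ

-- Γ̂₁ : K₄ on p₁..p₄ (= 0..3), with p₁p₂ and p₃p₄ negative.
K4ends : Fin 6 → Fin 4 × Fin 4
K4ends zero = (zero , suc zero)
K4ends (suc zero) = (suc (suc zero) , suc (suc (suc zero)))
K4ends (suc (suc zero)) = (zero , suc (suc zero))
K4ends (suc (suc (suc zero))) = (zero , suc (suc (suc zero)))
K4ends (suc (suc (suc (suc zero)))) = (suc zero , suc (suc zero))
K4ends (suc (suc (suc (suc (suc zero))))) = (suc zero , suc (suc (suc zero)))

K4loopless : ∀ e → proj₁ (K4ends e) ≢ proj₂ (K4ends e)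
K4loopless zero ()
K4loopless (suc zero) ()
K4loopless (suc (suc zero)) ()
K4loopless (suc (suc (suc zero))) ()
K4loopless (suc (suc (suc (suc zero)))) ()
K4loopless (suc (suc (suc (suc (suc zero))))) ()

K4 : Graph
K4 = record { nV = 4 ; nE = 6 ; ends = K4ends ; loopless = K4loopless }

Γ̂₁sign : Signature K4
Γ̂₁sign zero = true
Γ̂₁sign (suc zero) = true
Γ̂₁sign (suc (suc _)) = false

{-# OPTIONS --safe #-}
module Submission where

-- Minimality of σ means that switching at any vertex set X cannot decrease |E⁻|, i.e. at most
-- half of the edges of every cut ∂X are negative.  For X = {v} in a subcubic graph this allows
-- at most one negative edge at v, and 2|E⁻| = v(G) then forces exactly one: the negative edges
-- form a perfect matching v ↦ partner v.  Let x lie in no digon.  Bridgelessness gives x a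
-- positive edge xw, and balance of ∂{x, w} (which contains the negative edges at x and at w)
-- gives x a second positive neighbour.  For positive neighbours a ≠ b of x (neither is the
-- partner of x, as x is in no digon), balance of ∂{x, a, b} forces ab to be negative, and then
-- also keeps a and b out of digons.  Running the same argument at a and at b yields positive
-- edges from a and from b to the partner u of x.  So x, u, a, b span a copy of Γ̂₁ whose
-- vertices all have degree 3; as G is connected, G is this copy.

open import Data.Bool using (Bool; true; false; _xor_; not; _∧_; _∨_; T)
open import Data.Bool.ListAction using (any)
open import Data.Bool.Properties
  using (∧-zeroʳ; ∧-identityʳ; ∨-zeroʳ; xor-comm; xor-identityʳ) renaming (_≟_ to _≟ᴮ_)
open import Data.Fin using (Fin; zero; suc; _≟_)
open import Data.Fin.Patterns using (0F; 1F; 2F; 3F; 4F; 5F)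
open import Data.Fin.Properties using (all?; any?; ¬∀⟶∃¬)
open import Data.List as List using (List; []; _∷_; length)
open import Data.List.Membership.Propositional using (_∈_; _∉_)
open import Data.List.Membership.Propositional.Properties using (∈-map⁻)
open import Data.List.Properties using (length-map)
open import Data.List.Relation.Unary.All as All using (All; []; _∷_)
open import Data.List.Relation.Unary.All.Properties as All using (¬Any⇒All¬; All¬⇒¬Any)
open import Data.List.Relation.Unary.AllPairs using ([]; _∷_)
open import Data.List.Relation.Unary.Any as Any using (Any; here; there)
open import Data.List.Relation.Unary.Unique.DecPropositional (_≟_ {6}) using (unique?)
open import Data.List.Relation.Unary.Unique.Propositional using (Unique)
open import Data.List.Relation.Unary.Unique.Propositional.Properties as Unique using ()
open import Data.Nat using (ℕ; zero; suc; _+_; _*_; _∸_; _≤_; _<_; z≤n; s≤s; s≤s⁻¹)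
open import Data.Nat.ListAction using (sum)
open import Data.Nat.Properties
  using ( +-identityʳ; ≤-refl; ≤-trans; ≤-reflexive; +-mono-≤; +-monoˡ-≤; +-monoʳ-≤
        ; +-cancelˡ-≤; *-monoʳ-≤; *-cancelˡ-<; m≤m+n; 1+n≰n; m+n≤o⇒m≤o∸n; +-*-semiring
        ; module ≤-Reasoning)
open import Algebra.Properties.Semiring.Sum +-*-semiring
  using (∑-distrib-+; ∑-comm; *-distribˡ-sum; sum-cong-≗) renaming (sum to ∑)
open import Data.Product using (Σ; _×_; _,_; proj₁; proj₂)
open import Data.Sum using (_⊎_; inj₁; inj₂)
open import Defs
open import Function using (_∘_)
open import Function.Bundles using (mk↔ₛ′)
open import Function.Definitions using (Injective)
open import Function.Properties.Inverse using (↔⇒⤖)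
open import Relation.Binary.PropositionalEquality
open import Relation.Nullary using (¬_; Dec; does; yes; no; contradiction)
open import Relation.Nullary.Decidable
  using ( isYes; isYes≗does; dec-true; dec-false; toWitness; toWitnessFalse
        ; _×-dec_; _⊎-dec_; _→-dec_)

isYes-true : ∀ {a} {A : Set a} (a? : Dec A) → A → isYes a? ≡ true
isYes-true a? a = trans (isYes≗does a?) (dec-true a? a)

isYes-false : ∀ {a} {A : Set a} (a? : Dec A) → ¬ A → isYes a? ≡ false
isYes-false a? ¬a = trans (isYes≗does a?) (dec-false a? ¬a)

∧-true⁻ : ∀ {x y} → x ∧ y ≡ true → x ≡ true × y ≡ true
∧-true⁻ {true} y≡true = refl , y≡true

countTrue≡∑ : ∀ {k} (f : Fin k → Bool) → countTrue f ≡ ∑ (b2n ∘ f)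
countTrue≡∑ {zero}  f = refl
countTrue≡∑ {suc k} f = cong (b2n (f zero) +_) (countTrue≡∑ (f ∘ suc))

countTrue-+ : ∀ {k} (f g : Fin k → Bool) →
              countTrue f + countTrue g ≡ ∑ (λ i → b2n (f i) + b2n (g i))
countTrue-+ f g = begin
  countTrue f + countTrue g        ≡⟨ cong₂ _+_ (countTrue≡∑ f) (countTrue≡∑ g) ⟩
  ∑ (b2n ∘ f) + ∑ (b2n ∘ g)        ≡⟨ ∑-distrib-+ (b2n ∘ f) (b2n ∘ g) ⟨
  ∑ (λ i → b2n (f i) + b2n (g i))  ∎
  where open ≡-Reasoning

countTrue-cong : ∀ {k} {f g : Fin k → Bool} → (∀ i → f i ≡ g i) → countTrue f ≡ countTrue g
countTrue-cong {f = f} {g} f≗g = begin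
  countTrue f  ≡⟨ countTrue≡∑ f ⟩
  ∑ (b2n ∘ f)  ≡⟨ sum-cong-≗ (cong b2n ∘ f≗g) ⟩
  ∑ (b2n ∘ g)  ≡⟨ countTrue≡∑ g ⟨
  countTrue g  ∎
  where open ≡-Reasoning

countTrue-mono : ∀ {k} {f g : Fin k → Bool} → (∀ i → f i ≡ true → g i ≡ true) →
                 countTrue f ≤ countTrue g
countTrue-mono {zero}  f⊆g = z≤n
countTrue-mono {suc k} f⊆g = +-mono-≤ (b2n-mono (f⊆g zero)) (countTrue-mono (f⊆g ∘ suc))
  where
  b2n-mono : ∀ {x y} → (x ≡ true → y ≡ true) → b2n x ≤ b2n y
  b2n-mono {false}         _   = z≤n
  b2n-mono {true}  {true}  _   = ≤-refl
  b2n-mono {true}  {false} x⇒y with () ← x⇒y refl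

countTrue-false : ∀ {k} {f : Fin k → Bool} → (∀ i → f i ≡ false) → countTrue f ≡ 0
countTrue-false {zero}      _   = refl
countTrue-false {suc k} {f} f≡0 rewrite f≡0 zero = countTrue-false (f≡0 ∘ suc)

countTrue-≟ : ∀ {k} (i : Fin k) → countTrue (λ j → isYes (j ≟ i)) ≡ 1
countTrue-≟ {suc k} zero    = cong suc (countTrue-false {k} (λ _ → refl))
countTrue-≟         (suc i) = trans (countTrue-cong isYes-suc) (countTrue-≟ i)
  where
  isYes-suc : ∀ j → isYes (suc j ≟ suc i) ≡ isYes (j ≟ i)
  isYes-suc j = trans (isYes≗does (suc j ≟ suc i)) (sym (isYes≗does (j ≟ i)))

countTrue-∨-∧ : ∀ {k} (f g : Fin k → Bool) →
                countTrue (λ i → f i ∨ g i) + countTrue (λ i → f i ∧ g i) ≡ countTrue f + countTrue g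
countTrue-∨-∧ f g = begin
  countTrue (λ i → f i ∨ g i) + countTrue (λ i → f i ∧ g i)
    ≡⟨ countTrue-+ (λ i → f i ∨ g i) (λ i → f i ∧ g i) ⟩
  ∑ (λ i → b2n (f i ∨ g i) + b2n (f i ∧ g i))
    ≡⟨ sum-cong-≗ (λ i → pointwise (f i) (g i)) ⟩
  ∑ (λ i → b2n (f i) + b2n (g i))
    ≡⟨ countTrue-+ f g ⟨
  countTrue f + countTrue g
    ∎
  where
  open ≡-Reasoning
  pointwise : ∀ x y → b2n (x ∨ y) + b2n (x ∧ y) ≡ b2n x + b2n y
  pointwise true  y     = refl
  pointwise false true  = refl
  pointwise false false = refl

countTrue-∨ : ∀ {k} (f g : Fin k → Bool) → countTrue (λ i → f i ∨ g i) ≤ countTrue f + countTrue g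
countTrue-∨ f g = ≤-trans (m≤m+n _ _) (≤-reflexive (countTrue-∨-∧ f g))

countTrue-split : ∀ {k} (f g : Fin k → Bool) →
                  countTrue (λ i → f i ∧ g i) + countTrue (λ i → f i ∧ not (g i)) ≡ countTrue f
countTrue-split f g = begin
  countTrue (λ i → f i ∧ g i) + countTrue (λ i → f i ∧ not (g i))
    ≡⟨ countTrue-+ (λ i → f i ∧ g i) (λ i → f i ∧ not (g i)) ⟩
  ∑ (λ i → b2n (f i ∧ g i) + b2n (f i ∧ not (g i)))
    ≡⟨ sum-cong-≗ (λ i → pointwise (f i) (g i)) ⟩
  ∑ (b2n ∘ f)
    ≡⟨ countTrue≡∑ f ⟨
  countTrue f
    ∎
  where
  open ≡-Reasoning
  pointwise : ∀ x y → b2n (x ∧ y) + b2n (x ∧ not y) ≡ b2n x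
  pointwise true  true  = refl
  pointwise true  false = refl
  pointwise false y     = refl

countTrue-xor : ∀ {k} (f g : Fin k → Bool) →
  countTrue (λ i → f i xor g i) + 2 * countTrue (λ i → f i ∧ g i) ≡ countTrue f + countTrue g
countTrue-xor f g = begin
  countTrue (λ i → f i xor g i) + 2 * countTrue (λ i → f i ∧ g i)
    ≡⟨ cong₂ _+_ (countTrue≡∑ (λ i → f i xor g i)) (cong (2 *_) (countTrue≡∑ (λ i → f i ∧ g i))) ⟩
  ∑ (λ i → b2n (f i xor g i)) + 2 * ∑ (λ i → b2n (f i ∧ g i))
    ≡⟨ cong (∑ (λ i → b2n (f i xor g i)) +_) (*-distribˡ-sum 2 (λ i → b2n (f i ∧ g i))) ⟩
  ∑ (λ i → b2n (f i xor g i)) + ∑ (λ i → 2 * b2n (f i ∧ g i))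
    ≡⟨ ∑-distrib-+ (λ i → b2n (f i xor g i)) (λ i → 2 * b2n (f i ∧ g i)) ⟨
  ∑ (λ i → b2n (f i xor g i) + 2 * b2n (f i ∧ g i))
    ≡⟨ sum-cong-≗ (λ i → pointwise (f i) (g i)) ⟩
  ∑ (λ i → b2n (f i) + b2n (g i))
    ≡⟨ countTrue-+ f g ⟨
  countTrue f + countTrue g
    ∎
  where
  open ≡-Reasoning
  pointwise : ∀ x y → b2n (x xor y) + 2 * b2n (x ∧ y) ≡ b2n x + b2n y
  pointwise true  true  = refl
  pointwise true  false = refl
  pointwise false true  = refl
  pointwise false false = refl

_without_ : ∀ {k} → (Fin k → Bool) → Fin k → Fin k → Bool
(f without i) j = f j ∧ not (isYes (j ≟ i))

countTrue-without : ∀ {k} {f : Fin k → Bool} {i} → f i ≡ true →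
                    countTrue f ≡ suc (countTrue (f without i))
countTrue-without {f = f} {i} fi = begin
  countTrue f
    ≡⟨ countTrue-split f (λ j → isYes (j ≟ i)) ⟨
  countTrue (λ j → f j ∧ isYes (j ≟ i)) + countTrue (f without i)
    ≡⟨ cong (_+ countTrue (f without i)) at-i ⟩
  suc (countTrue (f without i))
    ∎
  where
  open ≡-Reasoning
  only-i : ∀ j → f j ∧ isYes (j ≟ i) ≡ isYes (j ≟ i)
  only-i j with j ≟ i
  ... | yes refl = cong (_∧ true) fi
  ... | no  _    = ∧-zeroʳ (f j)
  at-i : countTrue (λ j → f j ∧ isYes (j ≟ i)) ≡ 1
  at-i = trans (countTrue-cong only-i) (countTrue-≟ i)

without-true⁻ : ∀ {k} {f : Fin k → Bool} {i j} → (f without i) j ≡ true → f j ≡ true × j ≢ i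
without-true⁻ {f = f} {i} {j} h with j ≟ i
... | no  j≢i = trans (sym (∧-identityʳ (f j))) h , j≢i
... | yes _   with () ← trans (sym (∧-zeroʳ (f j))) h

without-All : ∀ {k} {f : Fin k → Bool} {i is} → All (i ≢_) is → All (λ j → f j ≡ true) is →
              All (λ j → (f without i) j ≡ true) is
without-All {f = f} {i} i∉is f-is = All.zipWith kept (f-is , i∉is)
  where
  kept : ∀ {j} → f j ≡ true × i ≢ j → (f without i) j ≡ true
  kept {j} (fj , i≢j) with j ≟ i
  ... | yes j≡i = contradiction (sym j≡i) i≢j
  ... | no  _   = cong (_∧ true) fj

length≤countTrue : ∀ {k} {f : Fin k → Bool} {is : List (Fin k)} → Unique is →
                   All (λ i → f i ≡ true) is → length is ≤ countTrue f
length≤countTrue                 []           []          = z≤n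
length≤countTrue {f = f} {i ∷ _} (i∉is ∷ !is) (fi ∷ f-is) =
  ≤-trans (s≤s (length≤countTrue !is (without-All {f = f} i∉is f-is)))
          (≤-reflexive (sym (countTrue-without {f = f} fi)))

length<countTrue⇒∃∉ : ∀ {k} {f : Fin k → Bool} {is : List (Fin k)} → Unique is →
                      All (λ i → f i ≡ true) is → length is < countTrue f →
                      Σ (Fin k) λ j → f j ≡ true × j ∉ is
length<countTrue⇒∃∉ {suc k} {f} [] [] 0<count with f zero in f0
... | true  = zero , f0 , λ ()
... | false = let j , fj , _ = length<countTrue⇒∃∉ {f = f ∘ suc} [] [] 0<count in suc j , fj , λ ()
length<countTrue⇒∃∉ {f = f} (i∉is ∷ !is) (fi ∷ f-is) len<count
  with j , fj , j∉is ← length<countTrue⇒∃∉ !is (without-All {f = f} i∉is f-is)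
                         (s≤s⁻¹ (≤-trans len<count (≤-reflexive (countTrue-without {f = f} fi))))
  with fj , j≢i ← without-true⁻ {f = f} fj
  = j , fj , λ { (here j≡i) → j≢i j≡i ; (there j∈is) → j∉is j∈is }

∑-≤1⇒≤ : ∀ {n} (g : Fin n → ℕ) → (∀ i → g i ≤ 1) → ∑ g ≤ n
∑-≤1⇒≤ {zero}  g _   = z≤n
∑-≤1⇒≤ {suc n} g g≤1 = +-mono-≤ (g≤1 zero) (∑-≤1⇒≤ (g ∘ suc) (g≤1 ∘ suc))

∑≡n⇒all≡1 : ∀ {n} (g : Fin n → ℕ) → (∀ i → g i ≤ 1) → ∑ g ≡ n → ∀ i → g i ≡ 1
∑≡n⇒all≡1 {suc n} g g≤1 ∑g≡1+n = λ
  { zero    → proj₁ head-and-tail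
  ; (suc i) → ∑≡n⇒all≡1 (g ∘ suc) (g≤1 ∘ suc) (proj₂ head-and-tail) i
  }
  where
  split : ∀ a {s} → a ≤ 1 → s ≤ n → a + s ≡ suc n → a ≡ 1 × s ≡ n
  split 0             _        s≤n refl = contradiction s≤n 1+n≰n
  split 1             _        _   refl = refl , refl
  split (suc (suc _)) (s≤s ()) _   _
  head-and-tail : g zero ≡ 1 × ∑ (g ∘ suc) ≡ n
  head-and-tail = split (g zero) (g≤1 zero) (∑-≤1⇒≤ (g ∘ suc) (g≤1 ∘ suc)) ∑g≡1+n

module Incidence (G : Graph) where

  Vertex : Set
  Vertex = Fin (nV G)

  Edge : Set
  Edge = Fin (nE G)

  private
    variable
      e : Edge
      v w y z : Vertex

  ends-Joins : ∀ e → Joins G e (proj₁ (ends G e)) (proj₂ (ends G e))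
  ends-Joins e = inj₁ (refl , refl)

  Joins-sym : Joins G e v w → Joins G e w v
  Joins-sym (inj₁ (p , q)) = inj₂ (p , q)
  Joins-sym (inj₂ (p , q)) = inj₁ (p , q)

  Joins⇒≢ : Joins G e v w → v ≢ w
  Joins⇒≢ {e} (inj₁ (refl , refl)) = loopless G e
  Joins⇒≢ {e} (inj₂ (refl , refl)) = loopless G e ∘ sym

  Joins? : ∀ e v w → Dec (Joins G e v w)
  Joins? e v w = (proj₁ (ends G e) ≟ v ×-dec proj₂ (ends G e) ≟ w)
           ⊎-dec (proj₁ (ends G e) ≟ w ×-dec proj₂ (ends G e) ≟ v)

  Joins-resp : ∀ {e′ v′ w′} → e ≡ e′ → v ≡ v′ → w ≡ w′ → Joins G e v w → Joins G e′ v′ w′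
  Joins-resp refl refl refl evw = evw

  Joins-same : Joins G e v w → Joins G e y z → (v ≡ y × w ≡ z) ⊎ (v ≡ z × w ≡ y)
  Joins-same (inj₁ (refl , refl)) (inj₁ (refl , refl)) = inj₁ (refl , refl)
  Joins-same (inj₁ (refl , refl)) (inj₂ (refl , refl)) = inj₂ (refl , refl)
  Joins-same (inj₂ (refl , refl)) (inj₁ (refl , refl)) = inj₂ (refl , refl)
  Joins-same (inj₂ (refl , refl)) (inj₂ (refl , refl)) = inj₁ (refl , refl)

  Joins-functional : Joins G e v w → Joins G e v z → w ≡ z
  Joins-functional evw evz with Joins-same evw evz
  ... | inj₁ (_ , w≡z) = w≡z
  ... | inj₂ (v≡z , _) = contradiction v≡z (Joins⇒≢ evz)

  Joins⇒incident : Joins G e v w → incident G e v ≡ true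
  Joins⇒incident {e} {v} (inj₁ (refl , _)) =
    cong (_∨ isYes (v ≟ proj₂ (ends G e))) (isYes-true (v ≟ v) refl)
  Joins⇒incident {e} {v} (inj₂ (_ , refl)) =
    trans (cong (isYes (v ≟ proj₁ (ends G e)) ∨_) (isYes-true (v ≟ v) refl)) (∨-zeroʳ _)

  incident⇒Joins : incident G e v ≡ true → Σ Vertex (Joins G e v)
  incident⇒Joins {e} {v} e∋v with v ≟ proj₁ (ends G e) | v ≟ proj₂ (ends G e)
  ... | yes refl | _        = proj₂ (ends G e) , inj₁ (refl , refl)
  ... | no _     | yes refl = proj₁ (ends G e) , inj₂ (refl , refl)
  ... | no _     | no _     with () ← e∋v

  Joins-endpoint : Joins G e v w → incident G e y ≡ true → y ≡ v ⊎ y ≡ w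
  Joins-endpoint evw e∋y with Joins-same (proj₂ (incident⇒Joins e∋y)) evw
  ... | inj₁ (y≡v , _) = inj₁ y≡v
  ... | inj₂ (y≡w , _) = inj₂ y≡w

  Reach⇒first-edge : ∀ {ok} → Reach G ok v w → v ≢ w →
                     Σ Edge λ e → T (ok e) × incident G e v ≡ true
  Reach⇒first-edge here           v≢v = contradiction refl v≢v
  Reach⇒first-edge (stepˡ e ok _) _   = e , ok , Joins⇒incident (ends-Joins e)
  Reach⇒first-edge (stepʳ e ok _) _   = e , ok , Joins⇒incident (Joins-sym (ends-Joins e))

  countTrue-incident : ∀ e → countTrue (incident G e) ≡ 2
  countTrue-incident e = begin
    countTrue (incident G e)
      ≡⟨ +-identityʳ (countTrue (incident G e)) ⟨
    countTrue (incident G e) + 0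
      ≡⟨ cong (countTrue (incident G e) +_) (countTrue-false ends-differ) ⟨
    countTrue (incident G e) + countTrue (λ v → is v e₁ ∧ is v e₂)
      ≡⟨ countTrue-∨-∧ (λ v → is v e₁) (λ v → is v e₂) ⟩
    countTrue (λ v → is v e₁) + countTrue (λ v → is v e₂)
      ≡⟨ cong₂ _+_ (countTrue-≟ e₁) (countTrue-≟ e₂) ⟩
    2
      ∎
    where
    open ≡-Reasoning
    e₁ e₂ : Vertex
    e₁ = proj₁ (ends G e)
    e₂ = proj₂ (ends G e)
    is : Vertex → Vertex → Bool
    is v w = isYes (v ≟ w)
    ends-differ : ∀ v → is v e₁ ∧ is v e₂ ≡ false
    ends-differ v with v ≟ e₁
    ... | yes refl = isYes-false (e₁ ≟ e₂) (loopless G e)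
    ... | no _     = refl

  degreeIn : (Edge → Bool) → Vertex → ℕ
  degreeIn S v = countTrue (λ e → incident G e v ∧ S e)

  handshake : ∀ S → ∑ (degreeIn S) ≡ 2 * countTrue S
  handshake S = begin
    ∑ (degreeIn S)
      ≡⟨ sum-cong-≗ (λ v → countTrue≡∑ (λ e → incident G e v ∧ S e)) ⟩
    ∑ (λ v → ∑ (λ e → b2n (incident G e v ∧ S e)))
      ≡⟨ ∑-comm (λ v e → b2n (incident G e v ∧ S e)) ⟩
    ∑ (λ e → ∑ (λ v → b2n (incident G e v ∧ S e)))
      ≡⟨ sum-cong-≗ (λ e → trans (sym (countTrue≡∑ (λ v → incident G e v ∧ S e))) (at-edge e (S e))) ⟩
    ∑ (λ e → 2 * b2n (S e))
      ≡⟨ *-distribˡ-sum 2 (b2n ∘ S) ⟨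
    2 * ∑ (b2n ∘ S)
      ≡⟨ cong (2 *_) (countTrue≡∑ S) ⟨
    2 * countTrue S
      ∎
    where
    open ≡-Reasoning
    at-edge : ∀ e b → countTrue (λ v → incident G e v ∧ b) ≡ 2 * b2n b
    at-edge e true  = trans (countTrue-cong (λ v → ∧-identityʳ (incident G e v))) (countTrue-incident e)
    at-edge e false = countTrue-false (λ v → ∧-zeroʳ (incident G e v))

  cut : (Vertex → Bool) → Edge → Bool
  cut X e = X (proj₁ (ends G e)) xor X (proj₂ (ends G e))

  cut-Joins : ∀ X → Joins G e v w → cut X e ≡ X v xor X w
  cut-Joins     X (inj₁ (refl , refl)) = refl
  cut-Joins {e} X (inj₂ (refl , refl)) = xor-comm (X (proj₁ (ends G e))) (X (proj₂ (ends G e)))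

  crossing : ∀ X → Joins G e v w → X v ≡ true → X w ≡ false → cut X e ≡ true
  crossing X evw Xv Xw = trans (cut-Joins X evw) (cong₂ _xor_ Xv Xw)

  internal : ∀ X → Joins G e v w → X v ≡ true → X w ≡ true → cut X e ≡ false
  internal X evw Xv Xw = trans (cut-Joins X evw) (cong₂ _xor_ Xv Xw)

  crossing⁻ : ∀ X → Joins G e v w → cut X e ≡ true → X v ≡ true → X w ≡ false
  crossing⁻ {w = w} X evw cut-e Xv with X w in Xw
  ... | false = refl
  ... | true  with () ← trans (sym (internal X evw Xv Xw)) cut-e

  cut⇒inner-end : ∀ X → cut X e ≡ true → Σ Vertex λ v → incident G e v ≡ true × X v ≡ true
  cut⇒inner-end {e} X cut-e with X (proj₁ (ends G e)) in X₁ | X (proj₂ (ends G e)) in X₂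
  ... | true  | _     = proj₁ (ends G e) , Joins⇒incident (ends-Joins e) , X₁
  ... | false | true  = proj₂ (ends G e) , Joins⇒incident (Joins-sym (ends-Joins e)) , X₂
  ... | false | false with () ← cut-e

  ⟦_⟧ : List Vertex → Vertex → Bool
  ⟦ L ⟧ v = does (Any.any? (v ≟_) L)

  ∈⇒⟦⟧ : ∀ L → v ∈ L → ⟦ L ⟧ v ≡ true
  ∈⇒⟦⟧ {v} L = dec-true (Any.any? (v ≟_) L)

  ∉⇒⟦⟧ : ∀ L → All (v ≢_) L → ⟦ L ⟧ v ≡ false
  ∉⇒⟦⟧ {v} L v∉L = dec-false (Any.any? (v ≟_) L) (All¬⇒¬Any v∉L)

  ⟦⟧⇒∈ : ∀ {L} → ⟦ L ⟧ v ≡ true → v ∈ L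
  ⟦⟧⇒∈ {v} {L} _ with Any.any? (v ≟_) L
  ... | yes v∈L = v∈L

  countTrue≤∑degreeIn : ∀ S L → (∀ e → S e ≡ true → Any (λ v → incident G e v ≡ true) L) →
                        countTrue S ≤ sum (List.map (degreeIn S) L)
  countTrue≤∑degreeIn S L covered =
    ≤-trans (countTrue-mono (λ e Se → meets-true (covered e Se) Se)) (countTrue-meets L)
    where
    meets : List Vertex → Edge → Bool
    meets L e = any (λ v → incident G e v ∧ S e) L
    meets-true : ∀ {L} → Any (λ v → incident G e v ≡ true) L → S e ≡ true → meets L e ≡ true
    meets-true {e} {v ∷ L} (here e∋v) Se = cong₂ (λ a b → (a ∧ b) ∨ meets L e) e∋v Se
    meets-true {e} {v ∷ L} (there p)  Se =
      trans (cong ((incident G e v ∧ S e) ∨_) (meets-true p Se)) (∨-zeroʳ (incident G e v ∧ S e))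
    countTrue-meets : ∀ L → countTrue (meets L) ≤ sum (List.map (degreeIn S) L)
    countTrue-meets []      = ≤-reflexive (countTrue-false {f = meets []} (λ _ → refl))
    countTrue-meets (v ∷ L) = ≤-trans (countTrue-∨ (λ e → incident G e v ∧ S e) (meets L))
                                      (+-monoʳ-≤ (degreeIn S v) (countTrue-meets L))

  cut≤∑degreeIn : ∀ L → countTrue (cut ⟦ L ⟧) ≤ sum (List.map (degreeIn (cut ⟦ L ⟧)) L)
  cut≤∑degreeIn L = countTrue≤∑degreeIn (cut ⟦ L ⟧) L λ e cut-e →
    let v , e∋v , v∈X = cut⇒inner-end ⟦ L ⟧ cut-e
    in Any.map (λ { refl → e∋v }) (⟦⟧⇒∈ v∈X)

  degreeIn+length≤degree : ∀ S v {ws} → Unique ws →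
                           All (λ w → incident G w v ≡ true × S w ≡ false) ws →
                           degreeIn S v + length ws ≤ degree G v
  degreeIn+length≤degree S v {ws} !ws ws-outside = begin
    degreeIn S v + length ws
      ≤⟨ +-monoʳ-≤ (degreeIn S v) (length≤countTrue !ws (All.map outside ws-outside)) ⟩
    degreeIn S v + countTrue (λ e → incident G e v ∧ not (S e))
      ≡⟨ countTrue-split (λ e → incident G e v) S ⟩
    degree G v
      ∎
    where
    open ≤-Reasoning
    outside : ∀ {w} → incident G w v ≡ true × S w ≡ false → incident G w v ∧ not (S w) ≡ true
    outside (w∋v , Sw) = cong₂ (λ a b → a ∧ not b) w∋v Sw

  incident-edges-listed : ∀ {fs} → Unique fs → All (λ f → incident G f v ≡ true) fs →
                          degree G v ≤ length fs → incident G e v ≡ true → e ∈ fs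
  incident-edges-listed {v} {e} {fs} !fs fs∋v deg≤ e∋v with Any.any? (e ≟_) fs
  ... | yes e∈fs = e∈fs
  ... | no  e∉fs =
    contradiction (≤-trans (length≤countTrue (¬Any⇒All¬ fs e∉fs ∷ !fs) (e∋v ∷ fs∋v)) deg≤) 1+n≰n

  minimal⇒cut-balanced : ∀ σ → (∀ X → negCount G σ ≤ negCount G (switch G X σ)) →
                         ∀ X → 2 * countTrue (λ e → σ e ∧ cut X e) ≤ countTrue (cut X)
  minimal⇒cut-balanced σ minimal X = +-cancelˡ-≤ (countTrue σ) _ _ (begin
    countTrue σ + 2 * countTrue (λ e → σ e ∧ cut X e)
      ≤⟨ +-monoˡ-≤ _ (minimal X) ⟩
    countTrue (λ e → σ e xor cut X e) + 2 * countTrue (λ e → σ e ∧ cut X e)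
      ≡⟨ countTrue-xor σ (cut X) ⟩
    countTrue σ + countTrue (cut X)
      ∎)
    where open ≤-Reasoning

record Homomorphism (H G : Graph) : Set where
  field
    vertex : Fin (nV H) → Fin (nV G)
    edge   : Fin (nE H) → Fin (nE G)
    joins  : ∀ k → Joins G (edge k) (vertex (proj₁ (ends H k))) (vertex (proj₂ (ends H k)))

module HomomorphismProperties {H G : Graph} (φ : Homomorphism H G) where

  open Homomorphism φ
  open Incidence G

  private
    variable
      k : Fin (nE H)
      i j : Fin (nV H)

  joins⁺ : Joins H k i j → Joins G (edge k) (vertex i) (vertex j)
  joins⁺ {k} (inj₁ (refl , refl)) = joins k
  joins⁺ {k} (inj₂ (refl , refl)) = Joins-sym (joins k)

  joins⁻ : Injective _≡_ _≡_ vertex → Joins G (edge k) (vertex i) (vertex j) → Joins H k i j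
  joins⁻ {k} vertex-inj eij with Joins-same (joins k) eij
  ... | inj₁ (p , q) = inj₁ (vertex-inj p , vertex-inj q)
  ... | inj₂ (p , q) = inj₂ (vertex-inj p , vertex-inj q)

  VertexInImage : Vertex → Set
  VertexInImage v = Σ (Fin (nV H)) λ j → v ≡ vertex j

  EdgeInImage : Edge → Set
  EdgeInImage e = Σ (Fin (nE H)) λ k → e ≡ edge k

  EdgeClosed : Set
  EdgeClosed = ∀ j e → incident G e (vertex j) ≡ true → EdgeInImage e

  module _ (closed : EdgeClosed) where

    Joins-image : ∀ {e v w} → Joins G e v w → VertexInImage v → VertexInImage w
    Joins-image {e} evw (j , refl) with closed j e (Joins⇒incident evw)
    ... | k , refl with Joins-endpoint (joins k) (Joins⇒incident (Joins-sym evw))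
    ... | inj₁ w≡ = proj₁ (ends H k) , w≡
    ... | inj₂ w≡ = proj₂ (ends H k) , w≡

    Reach-image : ∀ {ok v w} → Reach G ok v w → VertexInImage v → VertexInImage w
    Reach-image here              v∈ = v∈
    Reach-image (stepˡ e _ reach) v∈ = Reach-image reach (Joins-image (ends-Joins e) v∈)
    Reach-image (stepʳ e _ reach) v∈ = Reach-image reach (Joins-image (Joins-sym (ends-Joins e)) v∈)

    vertex-surjective : ∀ {ok} → ConnectedUsing G ok → Fin (nV H) → ∀ v → VertexInImage v
    vertex-surjective connected j₀ v = Reach-image (connected (vertex j₀) v) (j₀ , refl)

    edge-surjective : (∀ v → VertexInImage v) → ∀ e → EdgeInImage e
    edge-surjective onto e with j , e₁≡ ← onto (proj₁ (ends G e)) =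
      closed j e (subst (λ v → incident G e v ≡ true) e₁≡ (Joins⇒incident (ends-Joins e)))

  toSignedIso : Injective _≡_ _≡_ vertex → Injective _≡_ _≡_ edge →
                (∀ v → VertexInImage v) → (∀ e → EdgeInImage e) →
                ∀ {σ τ} → (∀ k → σ (edge k) ≡ τ k) → SignedIso G σ H τ
  toSignedIso vertex-inj edge-inj onto-v onto-e {σ} signs = record
    { vmap          = ↔⇒⤖ (mk↔ₛ′ toV vertex (λ j → vertex-inj (sym (proj₂ (onto-v (vertex j)))))
                                             (λ v → sym (proj₂ (onto-v v))))
    ; emap          = ↔⇒⤖ (mk↔ₛ′ toE edge (λ k → edge-inj (sym (proj₂ (onto-e (edge k)))))
                                           (λ e → sym (proj₂ (onto-e e))))
    ; preservesEnds = λ e → joins⁻ vertex-inj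
        (Joins-resp (proj₂ (onto-e e)) (proj₂ (onto-v _)) (proj₂ (onto-v _)) (ends-Joins e))
    ; preservesSign = λ e → trans (sym (signs (toE e))) (cong σ (sym (proj₂ (onto-e e))))
    }
    where
    toV : Vertex → Fin (nV H)
    toV v = proj₁ (onto-v v)
    toE : Edge → Fin (nE H)
    toE e = proj₁ (onto-e e)

K4-complete : ∀ i j → i ≢ j → Σ (Fin 6) λ k → Joins K4 k i j
K4-complete i j i≢j
  with toWitness {a? = all? λ i → all? λ j → i ≟ j ⊎-dec any? λ k → Incidence.Joins? K4 k i j} _ i j
... | inj₁ i≡j    = contradiction i≡j i≢j
... | inj₂ joined = joined

K4-simple : ∀ k l → Joins K4 l (proj₁ (K4ends k)) (proj₂ (K4ends k)) → k ≡ l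
K4-simple = toWitness {a? = all? λ k → all? λ l →
  Incidence.Joins? K4 l (proj₁ (K4ends k)) (proj₂ (K4ends k)) →-dec k ≟ l} _

K4-star : Fin 4 → List (Fin 6)
K4-star 0F = 0F ∷ 2F ∷ 3F ∷ []
K4-star 1F = 0F ∷ 4F ∷ 5F ∷ []
K4-star 2F = 1F ∷ 2F ∷ 4F ∷ []
K4-star 3F = 1F ∷ 3F ∷ 5F ∷ []

K4-star-length : ∀ j → length (K4-star j) ≡ 3
K4-star-length 0F = refl
K4-star-length 1F = refl
K4-star-length 2F = refl
K4-star-length 3F = refl

K4-star-unique : ∀ j → Unique (K4-star j)
K4-star-unique = toWitness {a? = all? λ j → unique? (K4-star j)} _

K4-star-incident : ∀ j → All (λ k → incident K4 k j ≡ true) (K4-star j)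
K4-star-incident 0F = refl ∷ refl ∷ refl ∷ []
K4-star-incident 1F = refl ∷ refl ∷ refl ∷ []
K4-star-incident 2F = refl ∷ refl ∷ refl ∷ []
K4-star-incident 3F = refl ∷ refl ∷ refl ∷ []

module _ {G : Graph} (φ : Homomorphism K4 G) where

  open Homomorphism φ
  open HomomorphismProperties φ
  open Incidence G

  K4-vertex-injective : Injective _≡_ _≡_ vertex
  K4-vertex-injective {i} {j} vi≡vj with i ≟ j
  ... | yes i≡j = i≡j
  ... | no  i≢j = let k , kij = K4-complete i j i≢j in contradiction vi≡vj (Joins⇒≢ (joins⁺ {k} kij))

  K4-edge-injective : Injective _≡_ _≡_ edge
  K4-edge-injective {k} {l} ek≡el =
    K4-simple k l (joins⁻ {l} K4-vertex-injective (subst (λ e → Joins G e _ _) ek≡el (joins k)))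

  K4-edge-closed : Subcubic G → EdgeClosed
  K4-edge-closed subcubic j e e∋vj = let k , _ , e≡ek = ∈-map⁻ edge listed in k , e≡ek
    where
    image-incident : ∀ {k} → incident K4 k j ≡ true → incident G (edge k) (vertex j) ≡ true
    image-incident {k} k∋j = Joins⇒incident (joins⁺ {k} (proj₂ (Incidence.incident⇒Joins K4 {k} k∋j)))
    image-length : length (List.map edge (K4-star j)) ≡ 3
    image-length = trans (length-map edge (K4-star j)) (K4-star-length j)
    listed : e ∈ List.map edge (K4-star j)
    listed = incident-edges-listed {vertex j}
               (Unique.map⁺ K4-edge-injective (K4-star-unique j))
               (All.map⁺ (All.map image-incident (K4-star-incident j)))
               (≤-trans (subcubic (vertex j)) (≤-reflexive (sym image-length)))
               e∋vj

  K4-homomorphism⇒SignedIso : Subcubic G → ConnectedUsing G (λ _ → true) →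
                              ∀ {σ τ} → (∀ k → σ (edge k) ≡ τ k) → SignedIso G σ K4 τ
  K4-homomorphism⇒SignedIso subcubic connected =
    toSignedIso K4-vertex-injective K4-edge-injective onto (edge-surjective closed onto)
    where
    closed : EdgeClosed
    closed = K4-edge-closed subcubic
    onto : ∀ v → VertexInImage v
    onto = vertex-surjective closed connected 0F

module Extremal (G : Graph) (σ : Signature G) (subcubic : Subcubic G)
                (minimal : ∀ X → negCount G σ ≤ negCount G (switch G X σ))
                (half : 2 * negCount G σ ≡ nV G) where

  open Incidence G

  private
    variable
      e : Edge
      v w x : Vertex

  balanced : ∀ X → 2 * countTrue (λ e → σ e ∧ cut X e) ≤ countTrue (cut X)
  balanced = minimal⇒cut-balanced σ minimal

  negative-degree≤1 : ∀ v → degreeIn σ v ≤ 1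
  negative-degree≤1 v = s≤s⁻¹ (*-cancelˡ-< 2 (degreeIn σ v) 2 (s≤s (begin
    2 * degreeIn σ v                     ≤⟨ *-monoʳ-≤ 2 (countTrue-mono negative⇒crossing) ⟩
    2 * countTrue (λ e → σ e ∧ cut X e)  ≤⟨ balanced X ⟩
    countTrue (cut X)                    ≤⟨ cut≤∑degreeIn (v ∷ []) ⟩
    degreeIn (cut X) v + 0               ≤⟨ degreeIn+length≤degree (cut X) v [] [] ⟩
    degree G v                           ≤⟨ subcubic v ⟩
    3                                    ∎)))
    where
    open ≤-Reasoning
    X : Vertex → Bool
    X = ⟦ v ∷ [] ⟧
    negative⇒crossing : ∀ e → incident G e v ∧ σ e ≡ true → σ e ∧ cut X e ≡ true
    negative⇒crossing e e∈ with e∋v , σe ← ∧-true⁻ {incident G e v} e∈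
                           with w , evw ← incident⇒Joins {e} {v} e∋v =
      cong₂ _∧_ σe (crossing X evw (∈⇒⟦⟧ (v ∷ []) (here refl)) (∉⇒⟦⟧ (v ∷ []) (Joins⇒≢ evw ∘ sym ∷ [])))

  negative-degree≡1 : ∀ v → degreeIn σ v ≡ 1
  negative-degree≡1 = ∑≡n⇒all≡1 (degreeIn σ) negative-degree≤1 (trans (handshake σ) half)

  mate-exists : ∀ v → Σ Edge λ e → incident G e v ∧ σ e ≡ true
  mate-exists v
    with e , e∈ , _ ← length<countTrue⇒∃∉ {f = λ e → incident G e v ∧ σ e} [] []
                        (≤-reflexive (sym (negative-degree≡1 v)))
    = e , e∈

  opaque
    mate : Vertex → Edge
    mate v = proj₁ (mate-exists v)

    mate-incident : ∀ v → incident G (mate v) v ≡ true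
    mate-incident v = proj₁ (∧-true⁻ {incident G (mate v) v} (proj₂ (mate-exists v)))

    mate-negative : ∀ v → σ (mate v) ≡ true
    mate-negative v = proj₂ (∧-true⁻ {incident G (mate v) v} (proj₂ (mate-exists v)))

    partner : Vertex → Vertex
    partner v = proj₁ (incident⇒Joins {mate v} {v} (mate-incident v))

    mate-Joins : ∀ v → Joins G (mate v) v (partner v)
    mate-Joins v = proj₂ (incident⇒Joins {mate v} {v} (mate-incident v))

  negative⇒mate : σ e ≡ true → incident G e v ≡ true → e ≡ mate v
  negative⇒mate {e} {v} σe e∋v with e ≟ mate v
  ... | yes e≡mate = e≡mate
  ... | no  e≢mate = contradiction (≤-trans two-negatives (≤-reflexive (negative-degree≡1 v))) 1+n≰n
    where
    two-negatives : 2 ≤ degreeIn σ v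
    two-negatives = length≤countTrue ((e≢mate ∷ []) ∷ [] ∷ [])
                      (cong₂ _∧_ e∋v σe ∷ cong₂ _∧_ (mate-incident v) (mate-negative v) ∷ [])

  negative-Joins⇒partner : σ e ≡ true → Joins G e v w → w ≡ partner v
  negative-Joins⇒partner {e} {v} {w} σe evw = Joins-functional
    (subst (λ e → Joins G e v w) (negative⇒mate σe (Joins⇒incident evw)) evw) (mate-Joins v)

  partner-involutive : ∀ v → partner (partner v) ≡ v
  partner-involutive v = sym (negative-Joins⇒partner (mate-negative v) (Joins-sym (mate-Joins v)))

  partner-swap : partner v ≡ w → v ≡ partner w
  partner-swap {v} pv≡w = trans (sym (partner-involutive v)) (cong partner pv≡w)

  partner-≢ : ∀ v → partner v ≢ v
  partner-≢ v = Joins⇒≢ (mate-Joins v) ∘ sym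

  positive-unless-mate : incident G e v ≡ true → e ≢ mate v → σ e ≡ false
  positive-unless-mate {e} e∋v e≢mate with σ e in σe
  ... | true  = contradiction (negative⇒mate σe e∋v) e≢mate
  ... | false = refl

  mate-≢ : w ≢ v → w ≢ partner v → mate v ≢ mate w
  mate-≢ {w} {v} w≢v w≢pv mv≡mw
    with Joins-endpoint (mate-Joins v) (subst (λ e → incident G e w ≡ true) (sym mv≡mw) (mate-incident w))
  ... | inj₁ w≡v  = w≢v w≡v
  ... | inj₂ w≡pv = w≢pv w≡pv

  sign-≢ : ∀ {e f} → σ e ≡ false → σ f ≡ true → e ≢ f
  sign-≢ σe σf refl with () ← trans (sym σe) σf

  negatives-in-cut : ∀ X {es} → Unique es → All (λ e → σ e ≡ true × cut X e ≡ true) es →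
                     2 * length es ≤ countTrue (cut X)
  negatives-in-cut X !es es-crossing = ≤-trans
    (*-monoʳ-≤ 2 (length≤countTrue !es (All.map (λ (σe , cut-e) → cong₂ _∧_ σe cut-e) es-crossing)))
    (balanced X)

  -- Stated with ∸ so that, for a concrete list ws, the bound is a numeral.
  degreeIn-cut≤ : ∀ X v {ws} → Unique ws → All (λ w → incident G w v ≡ true × cut X w ≡ false) ws →
                  degreeIn (cut X) v ≤ 3 ∸ length ws
  degreeIn-cut≤ X v !ws ws-internal =
    m+n≤o⇒m≤o∸n _ (≤-trans (degreeIn+length≤degree (cut X) v !ws ws-internal) (subcubic v))

  mate-crossing : ∀ X v → X v ≡ true → X (partner v) ≡ false →
                  σ (mate v) ≡ true × cut X (mate v) ≡ true
  mate-crossing X v Xv Xpv = mate-negative v , crossing X (mate-Joins v) Xv Xpv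

  internal-edge : ∀ X → Joins G e v w → X v ≡ true → X w ≡ true →
                  incident G e v ≡ true × cut X e ≡ false
  internal-edge X evw Xv Xw = Joins⇒incident evw , internal X evw Xv Xw

  positive-neighbour≢partner : ¬ InDigon G σ x → Joins G e x w → σ e ≡ false → w ≢ partner x
  positive-neighbour≢partner {x} {e} no-digon x-w σe refl =
    no-digon (partner x , e , mate x , x-w , mate-Joins x , σe , mate-negative x)

  module _ {x e w} (no-digon : ¬ InDigon G σ x) (x-w : Joins G e x w) (σe : σ e ≡ false) where

    private
      L : List Vertex
      L = w ∷ x ∷ []
      X : Vertex → Bool
      X = ⟦ L ⟧
      Xw : X w ≡ true
      Xw = ∈⇒⟦⟧ L (here refl)
      Xx : X x ≡ true
      Xx = ∈⇒⟦⟧ L (there (here refl))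
      w≢px : w ≢ partner x
      w≢px = positive-neighbour≢partner no-digon x-w σe
      Xpx : X (partner x) ≡ false
      Xpx = ∉⇒⟦⟧ L (w≢px ∘ sym ∷ partner-≢ x ∷ [])

      -- The negative edges at x and at w are distinct and both leave {w, x}, so the cut has at
      -- least four edges, at most two of them at w.
      two-cut-edges-at-x : 2 ≤ degreeIn (cut X) x
      two-cut-edges-at-x = subst (2 ≤_) (+-identityʳ _) (s≤s⁻¹ (s≤s⁻¹ (begin
        4
          ≤⟨ negatives-in-cut X ((mate-≢ (Joins⇒≢ x-w) (w≢px ∘ partner-swap ∘ sym) ∷ []) ∷ [] ∷ [])
               (mate-crossing X w Xw (∉⇒⟦⟧ L (partner-≢ w ∷ w≢px ∘ partner-swap ∷ []))
                ∷ mate-crossing X x Xx Xpx ∷ []) ⟩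
        countTrue (cut X)
          ≤⟨ cut≤∑degreeIn L ⟩
        degreeIn (cut X) w + (degreeIn (cut X) x + 0)
          ≤⟨ +-monoˡ-≤ _ (degreeIn-cut≤ X w ([] ∷ []) (internal-edge X (Joins-sym x-w) Xw Xx ∷ [])) ⟩
        2 + (degreeIn (cut X) x + 0)
          ∎)))
        where open ≤-Reasoning

    another-positive-neighbour : Σ Vertex λ b → Σ Edge λ f → Joins G f x b × σ f ≡ false × w ≢ b
    another-positive-neighbour =
      let f , f∈ , f∉ = length<countTrue⇒∃∉ ([] ∷ [])
                          (cong₂ _∧_ (mate-incident x) (proj₂ (mate-crossing X x Xx Xpx)) ∷ [])
                          two-cut-edges-at-x
          f∋x , cut-f = ∧-true⁻ {incident G f x} f∈
          b , x-b     = incident⇒Joins {f} {x} f∋x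
          Xb          = crossing⁻ X x-b cut-f Xx
      in b , f , x-b , positive-unless-mate f∋x (f∉ ∘ here)
       , λ w≡b → contradiction (trans (sym Xw) (trans (cong X w≡b) Xb)) λ ()

  record Cherry (x : Vertex) : Set where
    field
      a b         : Vertex
      ea eb       : Edge
      x-a         : Joins G ea x a
      x-b         : Joins G eb x b
      ea-positive : σ ea ≡ false
      eb-positive : σ eb ≡ false
      a≢b         : a ≢ b
      a≢partner   : a ≢ partner x
      b≢partner   : b ≢ partner x

  Cherry-swap : Cherry x → Cherry x
  Cherry-swap C = record
    { a = b ; b = a ; ea = eb ; eb = ea ; x-a = x-b ; x-b = x-a
    ; ea-positive = eb-positive ; eb-positive = ea-positive
    ; a≢b = a≢b ∘ sym ; a≢partner = b≢partner ; b≢partner = a≢partner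
    }
    where open Cherry C

  cherry-at : ¬ InDigon G σ x → Joins G e x w → σ e ≡ false → Cherry x
  cherry-at no-digon x-w σe =
    let b , f , x-b , σf , w≢b = another-positive-neighbour no-digon x-w σe
    in record
      { a = _ ; b = b ; ea = _ ; eb = f ; x-a = x-w ; x-b = x-b
      ; ea-positive = σe ; eb-positive = σf ; a≢b = w≢b
      ; a≢partner = positive-neighbour≢partner no-digon x-w σe
      ; b≢partner = positive-neighbour≢partner no-digon x-b σf
      }

  module _ {x} (C : Cherry x) where

    open Cherry C

    private
      L : List Vertex
      L = x ∷ a ∷ b ∷ []
      X : Vertex → Bool
      X = ⟦ L ⟧
      Xx : X x ≡ true
      Xx = ∈⇒⟦⟧ L (here refl)
      Xa : X a ≡ true
      Xa = ∈⇒⟦⟧ L (there (here refl))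
      Xb : X b ≡ true
      Xb = ∈⇒⟦⟧ L (there (there (here refl)))
      x≢a : x ≢ a
      x≢a = Joins⇒≢ x-a
      x≢b : x ≢ b
      x≢b = Joins⇒≢ x-b
      ea≢eb : ea ≢ eb
      ea≢eb refl = a≢b (Joins-functional x-a x-b)
      cut-degree-x : degreeIn (cut X) x ≤ 1
      cut-degree-x = degreeIn-cut≤ X x ((ea≢eb ∷ []) ∷ [] ∷ [])
                       (internal-edge X x-a Xx Xa ∷ internal-edge X x-b Xx Xb ∷ [])
      mate-x-crossing : σ (mate x) ≡ true × cut X (mate x) ≡ true
      mate-x-crossing =
        mate-crossing X x Xx (∉⇒⟦⟧ L (partner-≢ x ∷ a≢partner ∘ sym ∷ b≢partner ∘ sym ∷ []))

    -- Otherwise the negative edges at x, a and b are three distinct edges leaving {x, a, b}, so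
    -- balance demands six cut edges, while subcubicity leaves room for only 1 + 2 + 2.
    cherry-closes : partner a ≡ b
    cherry-closes with partner a ≟ b
    ... | yes pa≡b = pa≡b
    ... | no  pa≢b = contradiction six≤five 1+n≰n
      where
      six≤five : 2 * 3 ≤ 1 + (2 + (2 + 0))
      six≤five = begin
        2 * 3
          ≤⟨ negatives-in-cut X
               ((mate-≢ (x≢a ∘ sym) a≢partner ∷ mate-≢ (x≢b ∘ sym) b≢partner ∷ [])
                ∷ (mate-≢ (a≢b ∘ sym) (pa≢b ∘ sym) ∷ []) ∷ [] ∷ [])
               (mate-x-crossing
                ∷ mate-crossing X a Xa (∉⇒⟦⟧ L (a≢partner ∘ partner-swap ∷ partner-≢ a ∷ pa≢b ∷ []))
                ∷ mate-crossing X b Xb (∉⇒⟦⟧ L (b≢partner ∘ partner-swap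
                                               ∷ pa≢b ∘ sym ∘ partner-swap ∷ partner-≢ b ∷ []))
                ∷ []) ⟩
        countTrue (cut X)
          ≤⟨ cut≤∑degreeIn L ⟩
        degreeIn (cut X) x + (degreeIn (cut X) a + (degreeIn (cut X) b + 0))
          ≤⟨ +-mono-≤ cut-degree-x (+-mono-≤
               (degreeIn-cut≤ X a ([] ∷ []) (internal-edge X (Joins-sym x-a) Xa Xx ∷ []))
               (+-mono-≤ (degreeIn-cut≤ X b ([] ∷ []) (internal-edge X (Joins-sym x-b) Xb Xx ∷ []))
                         ≤-refl)) ⟩
        1 + (2 + (2 + 0))
          ∎
        where open ≤-Reasoning

    -- A digon at a must join a to its partner b; then all edges at a and b stay inside
    -- {x, a, b}, so the cut is just the negative edge at x, which violates balance.
    cherry-leg-no-digon : ¬ InDigon G σ a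
    cherry-leg-no-digon (w , e , e′ , a-w , a-w′ , σe , σe′) = contradiction two≤one 1+n≰n
      where
      a-b : Joins G e a b
      a-b = subst (Joins G e a) (trans (negative-Joins⇒partner σe′ a-w′) cherry-closes) a-w
      mate-a-b : Joins G (mate a) a b
      mate-a-b = subst (Joins G (mate a) a) cherry-closes (mate-Joins a)
      ea≢e : ea ≢ e
      ea≢e refl = x≢b (Joins-functional (Joins-sym x-a) a-b)
      eb≢e : eb ≢ e
      eb≢e refl = x≢a (Joins-functional (Joins-sym x-b) (Joins-sym a-b))
      mate-a≢ : ∀ {f} → σ f ≡ false → mate a ≢ f
      mate-a≢ σf = sign-≢ σf (mate-negative a) ∘ sym
      two≤one : 2 * 1 ≤ 1 + (0 + (0 + 0))
      two≤one = begin
        2 * 1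
          ≤⟨ negatives-in-cut X ([] ∷ []) (mate-x-crossing ∷ []) ⟩
        countTrue (cut X)
          ≤⟨ cut≤∑degreeIn L ⟩
        degreeIn (cut X) x + (degreeIn (cut X) a + (degreeIn (cut X) b + 0))
          ≤⟨ +-mono-≤ cut-degree-x (+-mono-≤
               (degreeIn-cut≤ X a
                 ((mate-a≢ ea-positive ∷ mate-a≢ σe ∷ []) ∷ (ea≢e ∷ []) ∷ [] ∷ [])
                 (internal-edge X mate-a-b Xa Xb ∷ internal-edge X (Joins-sym x-a) Xa Xx
                  ∷ internal-edge X a-b Xa Xb ∷ []))
               (+-mono-≤
                 (degreeIn-cut≤ X b
                   ((mate-a≢ eb-positive ∷ mate-a≢ σe ∷ []) ∷ (eb≢e ∷ []) ∷ [] ∷ [])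
                   (internal-edge X (Joins-sym mate-a-b) Xb Xa ∷ internal-edge X (Joins-sym x-b) Xb Xx
                    ∷ internal-edge X (Joins-sym a-b) Xb Xa ∷ []))
                 ≤-refl)) ⟩
        1 + (0 + (0 + 0))
          ∎
        where open ≤-Reasoning

  positive-edge-to-partner : ¬ InDigon G σ x → Joins G e x v → σ e ≡ false →
                             Σ Edge λ f → Joins G f x (partner v) × σ f ≡ false
  positive-edge-to-partner no-digon x-v σe =
    let C = cherry-at no-digon x-v σe
        open Cherry C
    in eb , subst (Joins G eb _) (sym (cherry-closes C)) x-b , eb-positive

  non-mate-edge : TwoEdgeConnected G → ∀ x → Σ Edge λ e → e ≢ mate x × incident G e x ≡ true
  non-mate-edge (_ , bridgeless) x
    with e , e-kept , e∋x ← Reach⇒first-edge (bridgeless (mate x) x (partner x)) (partner-≢ x ∘ sym)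
    = e , toWitnessFalse e-kept , e∋x

  Γ̂₁-homomorphism : TwoEdgeConnected G → ¬ InDigon G σ x →
                    Σ (Homomorphism K4 G) λ φ → ∀ k → σ (Homomorphism.edge φ k) ≡ Γ̂₁sign k
  Γ̂₁-homomorphism {x} two-edge-connected no-digon =
    let e , e≢mate , e∋x = non-mate-edge two-edge-connected x
        w , x-w          = incident⇒Joins {e} {x} e∋x
        C                = cherry-at no-digon x-w (positive-unless-mate e∋x e≢mate)
        open Cherry C
        fa , a-u , σfa   = positive-edge-to-partner (cherry-leg-no-digon C) (Joins-sym x-a) ea-positive
        fb , b-u , σfb   = positive-edge-to-partner (cherry-leg-no-digon (Cherry-swap C))
                                                    (Joins-sym x-b) eb-positive
    in record
         { vertex = λ { 0F → x ; 1F → partner x ; 2F → a ; 3F → b }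
         ; edge   = λ { 0F → mate x ; 1F → mate a ; 2F → ea ; 3F → eb ; 4F → fa ; 5F → fb }
         ; joins  = λ { 0F → mate-Joins x
                      ; 1F → subst (Joins G (mate a) a) (cherry-closes C) (mate-Joins a)
                      ; 2F → x-a ; 3F → x-b ; 4F → Joins-sym a-u ; 5F → Joins-sym b-u }
         }
     , λ { 0F → mate-negative x ; 1F → mate-negative a ; 2F → ea-positive ; 3F → eb-positive
         ; 4F → σfa ; 5F → σfb }

  Γ̂₁-iso : TwoEdgeConnected G → ¬ InDigon G σ x → SignedIso G σ K4 Γ̂₁sign
  Γ̂₁-iso two-edge-connected no-digon =
    let φ , signs = Γ̂₁-homomorphism two-edge-connected no-digon
    in K4-homomorphism⇒SignedIso φ subcubic (proj₁ two-edge-connected) signs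

SignedIso⇒IsoUpToSwitching : ∀ {G σ H τ} → SignedIso G σ H τ → IsoUpToSwitching G σ H τ
SignedIso⇒IsoUpToSwitching {σ = σ} ι = (λ _ → false) , record
  { vmap          = vmap
  ; emap          = emap
  ; preservesEnds = preservesEnds
  ; preservesSign = λ e → trans (preservesSign e) (sym (xor-identityʳ (σ e)))
  }
  where open SignedIso ι

InDigon? : ∀ G σ v → Dec (InDigon G σ v)
InDigon? G σ v = any? λ w → any? λ e → any? λ e′ →
  Joins? e v w ×-dec Joins? e′ v w ×-dec σ e ≟ᴮ false ×-dec σ e′ ≟ᴮ true
  where open Incidence G

lemma3p1 : (G : Graph) (σ : Signature G) →
    TwoEdgeConnected G → Subcubic G →
    IsFrustrationIndex G σ (negCount G σ) →
    2 * negCount G σ ≡ nV G →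
    IsoUpToSwitching G σ K4 Γ̂₁sign ⊎ (∀ v → InDigon G σ v)
lemma3p1 G σ two-edge-connected subcubic (_ , minimal) half with all? (InDigon? G σ)
... | yes all-in-digons = inj₂ all-in-digons
... | no  not-all =
  let v , no-digon = ¬∀⟶∃¬ (nV G) (InDigon G σ) (InDigon? G σ) not-all
  in inj₁ (SignedIso⇒IsoUpToSwitching
             (Extremal.Γ̂₁-iso G σ subcubic minimal half two-edge-connected no-digon))
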